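{- Let $A,B\subseteq\omega$ with $\rho(A)=\alpha$ and $\rho(B)=\beta$. Then $\rho(B\triangleright A)=\alpha\beta$.
   Context: For $S\subseteq\omega$ write $S=\{s_0<s_1<s_2<\cdots\}$ (with $s_n$ defined for $n<|S|$). $B\triangleright A=\{a_{b_n}: n\in\omega,\ a_{b_n}\text{ defined}\}$, the elements of $A$ whose index in increasing order lies in $B$. $\rho_n(S)=|S\cap\{0,\dots,n-1\}|/n$ and $\rho(S)=\lim_n\rho_n(S)$ when the limit exists. -}

module Defs where

open import Data.Bool using (Bool; true; false; _∧_)
open import Data.Nat using (ℕ; zero; suc; _≤_)
open import Data.Integer using (+_)
open import Data.Rational using (ℚ; _/_; _-_; _*_; ∣_∣; _<_; 0ℚ)
open import Data.Product using (Σ; _×_)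

Subset : Set
Subset = ℕ → Bool

count : Subset → ℕ → ℕ
count S zero = 0
count S (suc n) with S n
... | true  = suc (count S n)
... | false = count S n

-- B ▷ A : the elements x of A whose index in the increasing enumeration
-- of A (namely |A ∩ {0,…,x-1}|) lies in B.
_▷_ : Subset → Subset → Subset
(B ▷ A) x = A x ∧ B (count A x)

-- dens S n = ρ_{n+1}(S) = |S ∩ {0,…,n}| / (n+1)
dens : Subset → ℕ → ℚ
dens S n = (+ count S (suc n)) / suc n

Cauchy : (ℕ → ℚ) → Set
Cauchy s = (ε : ℚ) → 0ℚ < ε →
  Σ ℕ (λ N → (m n : ℕ) → N ≤ m → N ≤ n → ∣ s m - s n ∣ < ε)

ConvergesTo : (ℕ → ℚ) → ℚ → Set
ConvergesTo s q = (ε : ℚ) → 0ℚ < ε →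
  Σ ℕ (λ N → (n : ℕ) → N ≤ n → ∣ s n - q ∣ < ε)

{-# OPTIONS --safe #-}
-- With a = |A ∩ [0, n]|, the set (B ▷ A) ∩ [0, n] has |B ∩ [0, a)| elements, so the error
-- ρ_{n+1}(B ▷ A) − ρ_{n+1}(A) ρ_{n+1}(B) equals (a/(n+1)) (ρ_a(B) − ρ_{n+1}(B)). Let M be a Cauchy
-- modulus of ρ(B) for ε. If a > M, the error is small because a/(n+1) ≤ 1 and ρ(B) is Cauchy;
-- if a ≤ M, both terms lie in [0, M/(n+1)], which is small for large n.
module Submission where

open import Defs
open import Data.Rational using (_-_; _*_; 0ℚ)

open import Algebra.Properties.AbelianGroup using (⁻¹-anti-homo‿-)
open import Data.Bool using (true; false)
open import Data.Nat.Base as ℕ using (ℕ; zero; suc; s≤s)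
import Data.Nat.Properties as ℕ
open import Data.Integer.Base as ℤ using (+_; -[1+_])
import Data.Integer.Properties as ℤ
open import Data.Integer.Solver using (module +-*-Solver)
open import Data.Product using (Σ; _,_)
open import Data.Rational.Base as ℚ using (ℚ; mkℚ; 1ℚ; ∣_∣; _/_; _<_; _≤_; -_; toℚᵘ; NonNegative)
open import Data.Rational.Properties
import Data.Rational.Unnormalised.Base as ℚᵘ
import Data.Rational.Unnormalised.Properties as ℚᵘ
open import Data.Sum using (inj₁; inj₂)
open import Relation.Nullary using (yes; no)
open import Relation.Binary.PropositionalEquality using (_≡_; refl; sym; trans; cong; subst; subst₂)

count-≤ : ∀ S n → count S n ℕ.≤ n
count-≤ S zero = ℕ.z≤n
count-≤ S (suc n) with S n
... | true  = s≤s (count-≤ S n)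
... | false = ℕ.m≤n⇒m≤1+n (count-≤ S n)

count-▷ : ∀ A B n → count (B ▷ A) n ≡ count B (count A n)
count-▷ A B zero = refl
count-▷ A B (suc n) with A n | count-▷ A B n
... | false | ih = ih
... | true  | ih with B (count A n)
...   | true  = cong suc ih
...   | false = ih

dens-▷ : ∀ A B n → dens (B ▷ A) n ≡ + count B (count A (suc n)) / suc n
dens-▷ A B n = cong (λ c → + c / suc n) (count-▷ A B (suc n))

toℚᵘ-/suc : ∀ k m → toℚᵘ (+ k / suc m) ℚᵘ.≃ ℚᵘ.mkℚᵘ (+ k) m
toℚᵘ-/suc k m = toℚᵘ-fromℚᵘ (ℚᵘ.mkℚᵘ (+ k) m)

cross-≤⇒/-≤ : ∀ {k m k′ m′} → k ℕ.* suc m′ ℕ.≤ k′ ℕ.* suc m → + k / suc m ≤ + k′ / suc m′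
cross-≤⇒/-≤ {k} {m} {k′} {m′} le = toℚᵘ-cancel-≤
  (ℚᵘ.≤-respˡ-≃ (ℚᵘ.≃-sym (toℚᵘ-/suc k m)) (ℚᵘ.≤-respʳ-≃ (ℚᵘ.≃-sym (toℚᵘ-/suc k′ m′))
    (ℚᵘ.*≤* (subst₂ ℤ._≤_ (ℤ.pos-* k (suc m′)) (ℤ.pos-* k′ (suc m)) (ℤ.+≤+ le)))))

cross-<⇒/-< : ∀ {k m k′ m′} → k ℕ.* suc m′ ℕ.< k′ ℕ.* suc m → + k / suc m < + k′ / suc m′
cross-<⇒/-< {k} {m} {k′} {m′} lt = toℚᵘ-cancel-<
  (ℚᵘ.<-respˡ-≃ (ℚᵘ.≃-sym (toℚᵘ-/suc k m)) (ℚᵘ.<-respʳ-≃ (ℚᵘ.≃-sym (toℚᵘ-/suc k′ m′))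
    (ℚᵘ.*<* (subst₂ ℤ._<_ (ℤ.pos-* k (suc m′)) (ℤ.pos-* k′ (suc m)) (ℤ.+<+ lt)))))

/suc-monoˡ-≤ : ∀ k k′ m → k ℕ.≤ k′ → + k / suc m ≤ + k′ / suc m
/suc-monoˡ-≤ k k′ m le = cross-≤⇒/-≤ {k} {m} {k′} {m} (ℕ.*-monoˡ-≤ (suc m) le)

k≤1+m⇒k/[1+m]≤1 : ∀ k m → k ℕ.≤ suc m → + k / suc m ≤ 1ℚ
k≤1+m⇒k/[1+m]≤1 k m le =
  cross-≤⇒/-≤ {k} {m} {1} {0} (subst₂ ℕ._≤_ (sym (ℕ.*-identityʳ k)) (sym (ℕ.+-identityʳ (suc m))) le)

/suc-nonNeg : ∀ k m → NonNegative (+ k / suc m)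
/suc-nonNeg k m = normalize-nonNeg k (suc m)

0≤k/[1+m] : ∀ k m → 0ℚ ≤ + k / suc m
0≤k/[1+m] k m = nonNegative⁻¹ (+ k / suc m) {{/suc-nonNeg k m}}

[1+k]/[1+m]*c/[1+k]≡c/[1+m] : ∀ k m c → (+ suc k / suc m) * (+ c / suc k) ≡ + c / suc m
[1+k]/[1+m]*c/[1+k]≡c/[1+m] k m c = toℚᵘ-injective (begin
  toℚᵘ ((+ suc k / suc m) * (+ c / suc k))     ≈⟨ toℚᵘ-homo-* (+ suc k / suc m) (+ c / suc k) ⟩
  toℚᵘ (+ suc k / suc m) ℚᵘ.* toℚᵘ (+ c / suc k) ≈⟨ ℚᵘ.*-cong (toℚᵘ-/suc (suc k) m) (toℚᵘ-/suc c k) ⟩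
  ℚᵘ.mkℚᵘ (+ suc k) m ℚᵘ.* ℚᵘ.mkℚᵘ (+ c) k     ≈⟨ ℚᵘ.*≡* (cross-multiplied (+ suc k) (+ c) (+ suc m)) ⟩
  ℚᵘ.mkℚᵘ (+ c) m                              ≈⟨ toℚᵘ-/suc c m ⟨
  toℚᵘ (+ c / suc m)                           ∎)
  where
  open ℚᵘ.≃-Reasoning
  cross-multiplied : ∀ a b d → (a ℤ.* b) ℤ.* d ≡ b ℤ.* (d ℤ.* a)
  cross-multiplied = solve 3 (λ a b d → (a :* b) :* d := b :* (d :* a)) refl
    where open +-*-Solver

0≤q⇒p-q≤p : ∀ {p q} → 0ℚ ≤ q → p - q ≤ p
0≤q⇒p-q≤p {p} {q} 0≤q = subst (p - q ≤_) (+-identityʳ p) (+-monoʳ-≤ p (neg-antimono-≤ 0≤q))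

∣p-q∣≤r : ∀ {p q r} → 0ℚ ≤ p → 0ℚ ≤ q → p ≤ r → q ≤ r → ∣ p - q ∣ ≤ r
∣p-q∣≤r {p} {q} 0≤p 0≤q p≤r q≤r with ∣p∣≡p∨∣p∣≡-p (p - q)
... | inj₁ ∣p-q∣≡p-q  = subst (_≤ _) (sym ∣p-q∣≡p-q) (≤-trans (0≤q⇒p-q≤p 0≤q) p≤r)
... | inj₂ ∣p-q∣≡q-p = subst (_≤ _) (sym (trans ∣p-q∣≡q-p (⁻¹-anti-homo‿- +-0-abelianGroup p q)))
                          (≤-trans (0≤q⇒p-q≤p 0≤p) q≤r)

∣r*p-r*q∣≤∣p-q∣ : ∀ {r} p q → 0ℚ ≤ r → r ≤ 1ℚ → ∣ r * p - r * q ∣ ≤ ∣ p - q ∣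
∣r*p-r*q∣≤∣p-q∣ {r} p q 0≤r r≤1 = begin
  ∣ r * p - r * q ∣     ≡⟨ cong ∣_∣ (sym r*[p-q]≡r*p-r*q) ⟩
  ∣ r * (p - q) ∣       ≡⟨ ∣p*q∣≡∣p∣*∣q∣ r (p - q) ⟩
  ∣ r ∣ * ∣ p - q ∣     ≡⟨ cong (_* ∣ p - q ∣) (0≤p⇒∣p∣≡p 0≤r) ⟩
  r * ∣ p - q ∣         ≤⟨ *-monoʳ-≤-nonNeg ∣ p - q ∣ {{∣-∣-nonNeg (p - q)}} r≤1 ⟩
  1ℚ * ∣ p - q ∣        ≡⟨ *-identityˡ ∣ p - q ∣ ⟩
  ∣ p - q ∣             ∎
  where
  open ≤-Reasoning
  r*[p-q]≡r*p-r*q : r * (p - q) ≡ r * p - r * q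
  r*[p-q]≡r*p-r*q = trans (*-distribˡ-+ r p (- q)) (cong (r * p ℚ.+_) (sym (neg-distribʳ-* r q)))

K/[1+n]<ε-eventually : ∀ K ε → 0ℚ < ε → Σ ℕ λ N → ∀ n → N ℕ.≤ n → + K / suc n < ε
K/[1+n]<ε-eventually K (mkℚ (+ zero) _ _)    (ℚ.*<* (ℤ.+<+ ()))
K/[1+n]<ε-eventually K (mkℚ -[1+ _ ] _ _)    (ℚ.*<* ())
K/[1+n]<ε-eventually K ε@(mkℚ (+ suc p) d _) _ = K ℕ.* suc d , K/[1+n]<ε
  where
  K/[1+n]<ε : ∀ n → K ℕ.* suc d ℕ.≤ n → + K / suc n < ε
  K/[1+n]<ε n Kd≤n = subst (_ <_) (↥p/↧p≡p ε)
    (cross-<⇒/-< {K} {n} {suc p} {d} (ℕ.≤-trans (s≤s Kd≤n) (ℕ.m≤n*m (suc n) (suc p))))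

discrepancy : Subset → ℕ → ℕ → ℚ
discrepancy B n a = + count B a / suc n - (+ a / suc n) * dens B n

∣discrepancy∣≤∣dens-dens∣ : ∀ B {k n} → k ℕ.≤ n →
  ∣ discrepancy B n (suc k) ∣ ≤ ∣ dens B k - dens B n ∣
∣discrepancy∣≤∣dens-dens∣ B {k} {n} k≤n =
  subst (λ x → ∣ x - a/[1+n] * dens B n ∣ ≤ ∣ dens B k - dens B n ∣)
    ([1+k]/[1+m]*c/[1+k]≡c/[1+m] k n (count B (suc k)))
    (∣r*p-r*q∣≤∣p-q∣ (dens B k) (dens B n)
      (0≤k/[1+m] (suc k) n) (k≤1+m⇒k/[1+m]≤1 (suc k) n (s≤s k≤n)))
  where
  a/[1+n] : ℚ
  a/[1+n] = + suc k / suc n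

∣discrepancy∣≤K/[1+n] : ∀ B n K {a} → a ℕ.≤ K → ∣ discrepancy B n a ∣ ≤ + K / suc n
∣discrepancy∣≤K/[1+n] B n K {a} a≤K =
  ∣p-q∣≤r (0≤k/[1+m] (count B a) n) 0≤predicted
    (/suc-monoˡ-≤ (count B a) K n (ℕ.≤-trans (count-≤ B a) a≤K)) predicted≤K/[1+n]
  where
  a/[1+n] : ℚ
  a/[1+n] = + a / suc n
  instance
    _ : NonNegative a/[1+n]
    _ = /suc-nonNeg a n
    _ : NonNegative (dens B n)
    _ = /suc-nonNeg (count B (suc n)) n
  0≤predicted : 0ℚ ≤ a/[1+n] * dens B n
  0≤predicted = nonNegative⁻¹ _ {{nonNeg*nonNeg⇒nonNeg a/[1+n] (dens B n)}}
  dens≤1 : dens B n ≤ 1ℚ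
  dens≤1 = k≤1+m⇒k/[1+m]≤1 (count B (suc n)) n (count-≤ B (suc n))
  predicted≤K/[1+n] : a/[1+n] * dens B n ≤ + K / suc n
  predicted≤K/[1+n] = begin
    a/[1+n] * dens B n ≤⟨ *-monoˡ-≤-nonNeg a/[1+n] dens≤1 ⟩
    a/[1+n] * 1ℚ       ≡⟨ *-identityʳ a/[1+n] ⟩
    a/[1+n]            ≤⟨ /suc-monoˡ-≤ a K n a≤K ⟩
    + K / suc n        ∎
    where open ≤-Reasoning

discrepancy→0 : ∀ B → Cauchy (dens B) → ∀ ε → 0ℚ < ε →
  Σ ℕ λ N → ∀ n → N ℕ.≤ n → ∀ a → a ℕ.≤ suc n → ∣ discrepancy B n a ∣ < ε
discrepancy→0 B cauchy ε 0<ε with cauchy ε 0<ε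
... | M , dens-close with K/[1+n]<ε-eventually M ε 0<ε
... | N , M/[1+n]<ε = M ℕ.+ N , small
  where
  small : ∀ n → M ℕ.+ N ℕ.≤ n → ∀ a → a ℕ.≤ suc n → ∣ discrepancy B n a ∣ < ε
  small n M+N≤n zero _ =
    ≤-<-trans (∣discrepancy∣≤K/[1+n] B n M ℕ.z≤n) (M/[1+n]<ε n (ℕ.m+n≤o⇒n≤o M M+N≤n))
  small n M+N≤n (suc k) (s≤s k≤n) with M ℕ.≤? k
  ... | yes M≤k = ≤-<-trans (∣discrepancy∣≤∣dens-dens∣ B k≤n)
                            (dens-close k n M≤k (ℕ.m+n≤o⇒m≤o M M+N≤n))
  ... | no  M≰k = ≤-<-trans (∣discrepancy∣≤K/[1+n] B n M (ℕ.≰⇒> M≰k))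
                            (M/[1+n]<ε n (ℕ.m+n≤o⇒n≤o M M+N≤n))

corollary3p3 : (A B : Subset) → Cauchy (dens A) → Cauchy (dens B) →
    ConvergesTo (λ n → dens (B ▷ A) n - dens A n * dens B n) 0ℚ
corollary3p3 A B _ cauchyB ε 0<ε with discrepancy→0 B cauchyB ε 0<ε
... | N , small = N , λ n N≤n →
  subst (_< ε) (sym (error≡discrepancy n)) (small n N≤n (count A (suc n)) (count-≤ A (suc n)))
  where
  error≡discrepancy : ∀ n → ∣ dens (B ▷ A) n - dens A n * dens B n - 0ℚ ∣
                          ≡ ∣ discrepancy B n (count A (suc n)) ∣
  error≡discrepancy n =
    cong ∣_∣ (trans (+-identityʳ _) (cong (_- dens A n * dens B n) (dens-▷ A B n)))
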